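{- (i) As $n\to\infty$, $ex_3(n,\mathbb{H}_2^3S_2)=(1+o(1))\frac{n^2}{4}$. (ii) For every integer $t\ge 3$, as $n\to\infty$, $ex_3(n,\mathbb{H}_t^3S_2)\ge (t+o(1))\frac{n^2}{6}$.
   Context: $S_2$ denotes the star with two edges (the path with three vertices). A $3$-uniform hypergraph consists of a finite vertex set and a set of distinct $3$-element subsets (hyperedges). For an integer $t\ge1$ and a graph $F$, a hypergraph $\mathcal{F}$ is a $t$-heavy copy of $F$ if there exist an injection $i:V(F)\to V(\mathcal{F})$ and a map $h$ assigning to each edge $e$ of $F$ a set $h(e)$ of $t$ distinct hyperedges of $\mathcal{F}$ such that for every edge $e=xy$ of $F$, $\{i(x),i(y)\}\subseteq A$ for all $A\in h(e)$. $\mathbb{H}_t^3F$ is the family of $3$-uniform $t$-heavy copies of $F$. $ex_3(n,\mathbb{F})$ is the maximum number of hyperedges in a $3$-uniform hypergraph on $n$ vertices containing no member of $\mathbb{F}$ as a subhypergraph. -}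

module Defs where

open import Data.Nat using (ℕ; suc; _+_; _*_; _∸_; _≤_; _≥_)
open import Data.Fin using (Fin)
open import Data.Fin.Subset using (Subset; _∈_; ∣_∣)
open import Data.List using (List; length)
open import Data.List.Relation.Unary.All using (All)
open import Data.List.Relation.Unary.Unique.Propositional using (Unique)
open import Data.List.Membership.Propositional renaming (_∈_ to _∈ₗ_)
open import Data.Product using (Σ; _×_; ∃-syntax)
open import Relation.Binary.PropositionalEquality using (_≡_; _≢_)
open import Relation.Nullary using (¬_)

Is3Set : {n : ℕ} → Subset n → Set
Is3Set s = ∣ s ∣ ≡ 3

record Hypergraph3 (n : ℕ) : Set where
  field
    edges    : List (Subset n)
    uniform  : All Is3Set edges
    distinct : Unique edges
open Hypergraph3 public

size : {n : ℕ} → Hypergraph3 n → ℕ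
size H = length (edges H)

-- A list of exactly t distinct hyperedges of H, each containing both x and y:
-- this is a possible value h(xy) for an edge of F embedded at {x , y}.
HeavyPair : {n : ℕ} → ℕ → Hypergraph3 n → Fin n → Fin n → Set
HeavyPair {n} t H x y =
  Σ (List (Subset n)) λ L →
    (length L ≡ t) × Unique L × All (λ A → A ∈ₗ edges H) L
      × All (λ A → (x ∈ A) × (y ∈ A)) L

-- H contains (as a subhypergraph) a 3-uniform t-heavy copy of S₂, the path
-- y – u – w with center u: an injection of the three vertices (u, v, w
-- pairwise distinct) and, for each of the two edges uv, uw, a set of t
-- distinct hyperedges of H containing the images of its endpoints.
-- (The subhypergraph formed by these hyperedges is then a member of 𝕙ₜ³S₂.)
ContainsHeavyS2 : {n : ℕ} → ℕ → Hypergraph3 n → Set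
ContainsHeavyS2 {n} t H =
  ∃[ u ] ∃[ v ] ∃[ w ]
    (u ≢ v) × (u ≢ w) × (v ≢ w) × HeavyPair t H u v × HeavyPair t H u w

HeavyS2Free : {n : ℕ} → ℕ → Hypergraph3 n → Set
HeavyS2Free t H = ¬ ContainsHeavyS2 t H

module Submission where

-- Upper bound in (i): if two sides of a hyperedge were 2-heavy they would share a vertex and form a heavy S₂,
-- so every hyperedge has two sides lying in no other hyperedge. These give 4|H| distinct ordered pairs of
-- vertices, hence 4|H| ≤ n².
--
-- Lower bounds: match the vertices in pairs {2j, 2j+1}. If no unmatched pair is t-heavy, there is no heavy S₂,
-- as a vertex has only one partner. For (i) take all triples {2j, 2j+1, x} with x < 2j: an unmatched pair
-- {x < y} lies only in the triple through y's matched pair, and there are n²/4 − O(n) triples. For (ii), on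
-- three levels of m vertices each, take all (3m)²/2 − O(m) triples through a matched pair and, for each shift
-- s < t − 3, the triples {a, b, a + b + s mod m} with a + 1 < b in one level and the third vertex on the next
-- level (cyclically). An unmatched pair lies in at most two triples of the first kind and, given the shift,
-- in at most one of the second (two of its vertices determine the third), so in fewer than t triples; the
-- total is (3 + (t − 3)) (3m)²/6 − O(m).

open import Defs
open import Data.Bool using (true; false)
open import Data.Empty using (⊥; ⊥-elim)
open import Data.Fin using (Fin; zero; suc; toℕ; fromℕ<)
open import Data.Fin.Properties using (toℕ-fromℕ<; toℕ-injective)
  renaming (suc-injective to Fin-suc-injective)
open import Data.Fin.Subset using (Subset; _∈_; _∉_; ∣_∣) renaming (⊥ to ∅)
open import Data.Fin.Subset.Properties using (∉⊥; ∣⊥∣≡0)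
open import Data.List using (List; []; _∷_; length; _++_; map; concatMap; downFrom; allFin; cartesianProduct)
open import Data.List.Properties using (length-++; length-map; length-downFrom; length-tabulate; map-cong)
open import Data.List.Relation.Unary.All as All using (All; []; _∷_)
open import Data.List.Relation.Unary.All.Properties as All using ()
open import Data.List.Relation.Unary.Any using (here; there; _─_)
open import Data.List.Relation.Unary.AllPairs using ([]; _∷_)
open import Data.List.Relation.Unary.Unique.Propositional using (Unique)
open import Data.List.Relation.Unary.Unique.Propositional.Properties as Unique using (downFrom⁺)
open import Data.List.Relation.Binary.Subset.Propositional using (_⊆_)
open import Data.List.Membership.Propositional using (find) renaming (_∈_ to _∈ₗ_)
open import Data.List.Membership.Propositional.Properties
  using (∈-map⁻; ∈-++⁻; ∈-downFrom⁺; ∈-downFrom⁻; ∈-allFin; ∈-cartesianProduct⁺; ∈-concatMap⁻)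
open import Data.Nat using (ℕ; zero; suc; _+_; _*_; _∸_; _≤_; _<_; _≥_; z≤n; s≤s; s≤s⁻¹; _≤?_; _%_; _/_; NonZero)
open import Data.Nat.Properties
open import Data.Nat.ListAction using (sum)
open import Data.Nat.DivMod using (m≡m%n+[m/n]*n; m%n<n; m/n*n≤m; m*n/n≡m; /-monoˡ-≤; %-distribˡ-+; m<n⇒m%n≡m; n%n≡0; m≤n⇒[n∸m]%m≡n%m)
open import Data.Nat.Tactic.RingSolver using (solve-∀)
open import Data.Product using (Σ; _×_; _,_; proj₁; proj₂; ∃-syntax)
open import Function using (_∘_; case_of_)
open import Data.Sum using (_⊎_; inj₁; inj₂)
open import Data.Vec.Base using ([]; _∷_; here; there)
open import Relation.Binary.Definitions using (tri<; tri≈; tri>)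
open import Relation.Binary.PropositionalEquality
  using (_≡_; _≢_; refl; sym; trans; cong; cong₂; subst; subst₂; module ≡-Reasoning)
open import Relation.Nullary using (¬_; Dec; yes; no)
open import Relation.Nullary.Decidable using (decidable-stable)
open import Relation.Nullary.Decidable.Core using (¬¬-excluded-middle)

-- Counting duplicate-free lists

module _ {A : Set} where

  length-─ : ∀ {x} {ys : List A} (p : x ∈ₗ ys) → length ys ≡ suc (length (ys ─ p))
  length-─ (here _)  = refl
  length-─ (there p) = cong suc (length-─ p)

  ∈-─⁺ : ∀ {x y} {ys : List A} (p : x ∈ₗ ys) → y ∈ₗ ys → y ≢ x → y ∈ₗ (ys ─ p)
  ∈-─⁺ (here refl) (here y≡x) y≢x = ⊥-elim (y≢x y≡x)
  ∈-─⁺ (here refl) (there q)  _   = q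
  ∈-─⁺ (there p)   (here y≡x) _   = here y≡x
  ∈-─⁺ (there p)   (there q)  y≢x = there (∈-─⁺ p q y≢x)

  Unique-⊆⇒length≤ : ∀ {xs ys : List A} → Unique xs → xs ⊆ ys → length xs ≤ length ys
  Unique-⊆⇒length≤ {[]}     _             _  = z≤n
  Unique-⊆⇒length≤ {x ∷ xs} {ys} (x∉xs ∷ !xs) xs⊆ys =
    subst (suc (length xs) ≤_) (sym (length-─ x∈ys)) (s≤s (Unique-⊆⇒length≤ !xs xs⊆ys─x))
    where
      x∈ys = xs⊆ys (here refl)
      xs⊆ys─x : xs ⊆ (ys ─ x∈ys)
      xs⊆ys─x z∈xs = ∈-─⁺ x∈ys (xs⊆ys (there z∈xs)) λ { refl → All.lookup x∉xs z∈xs refl }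

module _ {A : Set} where

  private module _ {r : ℕ} {Tag : A → ℕ → Set} where

    Tagged : A → Set
    Tagged x = ∃[ j ] j < r × Tag x j

    tags : ∀ {xs} → All Tagged xs → List ℕ
    tags = All.reduce proj₁

    length-tags : ∀ {xs} (ts : All Tagged xs) → length (tags ts) ≡ length xs
    length-tags []       = refl
    length-tags (_ ∷ ts) = cong suc (length-tags ts)

    ∈-tags⁻ : ∀ {xs j} (ts : All Tagged xs) → j ∈ₗ tags ts → j < r × ∃[ x ] x ∈ₗ xs × Tag x j
    ∈-tags⁻ ((_ , j<r , tag) ∷ _)  (here refl) = j<r , _ , here refl , tag
    ∈-tags⁻ (_ ∷ ts) (there p) with j<r , x , x∈xs , tag ← ∈-tags⁻ ts p = j<r , x , there x∈xs , tag

    tags-unique : ∀ {xs} (ts : All Tagged xs) → Unique xs →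
                  (∀ {x y j} → x ∈ₗ xs → y ∈ₗ xs → Tag x j → Tag y j → x ≡ y) → Unique (tags ts)
    tags-unique []                       []            _   = []
    tags-unique ((j , _ , tag) ∷ ts) (x∉xs ∷ !xs) inj =
      All.tabulate fresh ∷ tags-unique ts !xs λ x∈ y∈ → inj (there x∈) (there y∈)
      where
        fresh : ∀ {j′} → j′ ∈ₗ tags ts → j ≢ j′
        fresh j′∈ refl with _ , y , y∈xs , tag′ ← ∈-tags⁻ ts j′∈ =
          All.lookup x∉xs y∈xs (inj (here refl) (there y∈xs) tag tag′)

  Unique-tagged⇒length≤ : ∀ r (Tag : A → ℕ → Set) {xs : List A} → Unique xs →
    All (λ x → ∃[ j ] j < r × Tag x j) xs →
    (∀ {x y j} → x ∈ₗ xs → y ∈ₗ xs → Tag x j → Tag y j → x ≡ y) → length xs ≤ r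
  Unique-tagged⇒length≤ r Tag {xs} !xs ts inj = begin
    length xs        ≡⟨ length-tags ts ⟨
    length (tags ts) ≤⟨ Unique-⊆⇒length≤ (tags-unique ts !xs inj) (∈-downFrom⁺ ∘ proj₁ ∘ ∈-tags⁻ ts) ⟩
    length (downFrom r) ≡⟨ length-downFrom r ⟩
    r ∎
    where open ≤-Reasoning

module _ {A B : Set} where

  Unique-map⁺ : ∀ (f : A → B) {xs} → Unique xs →
    (∀ {x y} → x ∈ₗ xs → y ∈ₗ xs → f x ≡ f y → x ≡ y) → Unique (map f xs)
  Unique-map⁺ f {[]}     []            _   = []
  Unique-map⁺ f {x ∷ xs} (x∉xs ∷ !xs) inj =
    All.map⁺ (All.tabulate fx≢) ∷ Unique-map⁺ f !xs λ x∈ y∈ → inj (there x∈) (there y∈)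
    where
      fx≢ : ∀ {y} → y ∈ₗ xs → f x ≢ f y
      fx≢ y∈xs fx≡fy = All.lookup x∉xs y∈xs (inj (here refl) (there y∈xs) fx≡fy)

  ∈-concatMap⁻′ : ∀ (f : A → List B) {xs y} → y ∈ₗ concatMap f xs → ∃[ x ] x ∈ₗ xs × y ∈ₗ f x
  ∈-concatMap⁻′ f = find ∘ ∈-concatMap⁻ f

  Unique-concatMap⁺ : ∀ (f : A → List B) {xs} → Unique xs → (∀ {x} → x ∈ₗ xs → Unique (f x)) →
    (∀ {x x′ y} → x ∈ₗ xs → x′ ∈ₗ xs → y ∈ₗ f x → y ∈ₗ f x′ → x ≡ x′) → Unique (concatMap f xs)
  Unique-concatMap⁺ f {[]}     []            _  _        = []
  Unique-concatMap⁺ f {x ∷ xs} (x∉xs ∷ !xs) !f disjoint =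
    Unique.++⁺ (!f (here refl)) (Unique-concatMap⁺ f !xs (!f ∘ there) λ x∈ x′∈ → disjoint (there x∈) (there x′∈))
      λ (y∈fx , y∈rest) → let x′ , x′∈xs , y∈fx′ = ∈-concatMap⁻′ f y∈rest in
        All.lookup x∉xs x′∈xs (disjoint (here refl) (there x′∈xs) y∈fx y∈fx′)

  Unique-concatMap⁺-indexed : ∀ (f : A → List B) (index : B → A) {xs} → Unique xs → (∀ x → Unique (f x)) →
    (∀ {x y} → y ∈ₗ f x → index y ≡ x) → Unique (concatMap f xs)
  Unique-concatMap⁺-indexed f index !xs !f index-f =
    Unique-concatMap⁺ f !xs (λ {x} _ → !f x) λ _ _ y∈fx y∈fx′ → trans (sym (index-f y∈fx)) (index-f y∈fx′)

  length-concatMap : ∀ (f : A → List B) xs → length (concatMap f xs) ≡ sum (map (length ∘ f) xs)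
  length-concatMap f []       = refl
  length-concatMap f (x ∷ xs) = trans (length-++ (f x)) (cong (length (f x) +_) (length-concatMap f xs))

sum-map-const : ∀ {A : Set} (g : A → ℕ) {c} xs → (∀ {x} → x ∈ₗ xs → g x ≡ c) → sum (map g xs) ≡ length xs * c
sum-map-const g []       _   = refl
sum-map-const g (x ∷ xs) g≡c = cong₂ _+_ (g≡c (here refl)) (sum-map-const g xs (g≡c ∘ there))

length-cartesianProduct : ∀ {A B : Set} (xs : List A) (ys : List B) →
  length (cartesianProduct xs ys) ≡ length xs * length ys
length-cartesianProduct []       ys = refl
length-cartesianProduct (x ∷ xs) ys =
  trans (length-++ (map (x ,_) ys)) (cong₂ _+_ (length-map (x ,_) ys) (length-cartesianProduct xs ys))

-- Triples of vertices, addressed by natural numbers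

private variable n : ℕ

-- A coordinate x ≥ n is silently ignored.
insert : ℕ → Subset n → Subset n
insert _       []      = []
insert zero    (_ ∷ s) = true ∷ s
insert (suc x) (b ∷ s) = b ∷ insert x s

∈-insert⁺ˡ : ∀ {x} (i : Fin n) (s : Subset n) → toℕ i ≡ x → i ∈ insert x s
∈-insert⁺ˡ zero    (_ ∷ s) refl = here
∈-insert⁺ˡ (suc i) (_ ∷ s) refl = there (∈-insert⁺ˡ i s refl)

∈-insert⁺ʳ : ∀ x {i : Fin n} {s : Subset n} → i ∈ s → i ∈ insert x s
∈-insert⁺ʳ zero    here      = here
∈-insert⁺ʳ zero    (there p) = there p
∈-insert⁺ʳ (suc x) here      = here
∈-insert⁺ʳ (suc x) (there p) = there (∈-insert⁺ʳ x p)

∈-insert⁻ : ∀ x (i : Fin n) (s : Subset n) → i ∈ insert x s → toℕ i ≡ x ⊎ i ∈ s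
∈-insert⁻ zero    zero    (_ ∷ s) here      = inj₁ refl
∈-insert⁻ zero    (suc i) (_ ∷ s) (there p) = inj₂ (there p)
∈-insert⁻ (suc x) zero    (_ ∷ s) here      = inj₂ here
∈-insert⁻ (suc x) (suc i) (_ ∷ s) (there p) with ∈-insert⁻ x i s p
... | inj₁ i≡x = inj₁ (cong suc i≡x)
... | inj₂ i∈s = inj₂ (there i∈s)

∣insert∣ : ∀ x (s : Subset n) → x < n → (∀ (i : Fin n) → toℕ i ≡ x → i ∉ s) → ∣ insert x s ∣ ≡ suc ∣ s ∣
∣insert∣ zero    (false ∷ s) _         _   = refl
∣insert∣ zero    (true ∷ s)  _         x∉s = ⊥-elim (x∉s zero refl here)
∣insert∣ (suc x) (false ∷ s) (s≤s x<n) x∉s = ∣insert∣ x s x<n λ i i≡x → x∉s (suc i) (cong suc i≡x) ∘ there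
∣insert∣ (suc x) (true ∷ s)  (s≤s x<n) x∉s = cong suc (∣insert∣ x s x<n λ i i≡x → x∉s (suc i) (cong suc i≡x) ∘ there)

insert-comm : ∀ x y (s : Subset n) → insert x (insert y s) ≡ insert y (insert x s)
insert-comm _       _       []      = refl
insert-comm zero    zero    (_ ∷ s) = refl
insert-comm zero    (suc y) (_ ∷ s) = refl
insert-comm (suc x) zero    (_ ∷ s) = refl
insert-comm (suc x) (suc y) (b ∷ s) = cong (b ∷_) (insert-comm x y s)

OneOf₃ : ℕ → ℕ → ℕ → ℕ → Set
OneOf₃ v x y z = v ≡ x ⊎ v ≡ y ⊎ v ≡ z

triple : ℕ → ℕ → ℕ → Subset n
triple x y z = insert x (insert y (insert z ∅))

∈-triple⁻ : ∀ {n x y z} (i : Fin n) → i ∈ triple x y z → OneOf₃ (toℕ i) x y z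
∈-triple⁻ {x = x} {y} {z} i i∈ with ∈-insert⁻ x i _ i∈
... | inj₁ i≡x = inj₁ i≡x
... | inj₂ i∈′ with ∈-insert⁻ y i _ i∈′
...   | inj₁ i≡y = inj₂ (inj₁ i≡y)
...   | inj₂ i∈″ with ∈-insert⁻ z i _ i∈″
...     | inj₁ i≡z = inj₂ (inj₂ i≡z)
...     | inj₂ i∈∅ = ⊥-elim (∉⊥ i∈∅)

∈-triple⁺ : ∀ {n x y z} (i : Fin n) → OneOf₃ (toℕ i) x y z → i ∈ triple x y z
∈-triple⁺             i (inj₁ i≡x)        = ∈-insert⁺ˡ i _ i≡x
∈-triple⁺ {x = x}     i (inj₂ (inj₁ i≡y)) = ∈-insert⁺ʳ x (∈-insert⁺ˡ i _ i≡y)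
∈-triple⁺ {x = x} {y} i (inj₂ (inj₂ i≡z)) = ∈-insert⁺ʳ x (∈-insert⁺ʳ y (∈-insert⁺ˡ i _ i≡z))

∣triple∣≡3 : ∀ {n x y z} → x < n → y < n → z < n → x ≢ y → x ≢ z → y ≢ z → ∣ triple {n} x y z ∣ ≡ 3
∣triple∣≡3 {n} {x} {y} {z} x<n y<n z<n x≢y x≢z y≢z = begin
  ∣ triple {n} x y z ∣                   ≡⟨ ∣insert∣ x _ x<n x∉ ⟩
  suc ∣ insert {n} y (insert z ∅) ∣     ≡⟨ cong suc (∣insert∣ y _ y<n y∉) ⟩
  suc (suc ∣ insert {n} z ∅ ∣)          ≡⟨ cong (λ c → 2 + c) (∣insert∣ z _ z<n λ _ _ → ∉⊥) ⟩
  suc (suc (suc ∣ ∅ {n} ∣))             ≡⟨ cong (3 +_) (∣⊥∣≡0 n) ⟩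
  3 ∎
  where
    open ≡-Reasoning
    only-z : ∀ i → i ∈ insert z ∅ → toℕ i ≡ z
    only-z i i∈ with ∈-insert⁻ z i _ i∈
    ... | inj₁ i≡z = i≡z
    ... | inj₂ i∈∅ = ⊥-elim (∉⊥ i∈∅)
    y∉ : ∀ i → toℕ i ≡ y → i ∉ insert z ∅
    y∉ i refl = y≢z ∘ only-z i
    x∉ : ∀ i → toℕ i ≡ x → i ∉ insert y (insert z ∅)
    x∉ i refl i∈ with ∈-insert⁻ y i _ i∈
    ... | inj₁ x≡y = x≢y x≡y
    ... | inj₂ i∈′ = x≢z (only-z i i∈′)

triple-swap : ∀ x y z → triple {n} x y z ≡ triple y x z
triple-swap x y z = insert-comm x y _

triple-≡⇒OneOf₃ : ∀ {x y z x′ y′ z′} → triple {n} x y z ≡ triple x′ y′ z′ →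
                  ∀ {v} → v < n → OneOf₃ v x y z → OneOf₃ v x′ y′ z′
triple-≡⇒OneOf₃ eq v<n v∈ =
  subst (λ w → OneOf₃ w _ _ _) (toℕ-fromℕ< v<n)
    (∈-triple⁻ i (subst (i ∈_) eq (∈-triple⁺ i (subst (λ w → OneOf₃ w _ _ _) (sym (toℕ-fromℕ< v<n)) v∈))))
  where i = fromℕ< v<n

elements : Subset n → List (Fin n)
elements []          = []
elements (true ∷ s)  = zero ∷ map suc (elements s)
elements (false ∷ s) = map suc (elements s)

length-elements : (s : Subset n) → length (elements s) ≡ ∣ s ∣
length-elements []          = refl
length-elements (true ∷ s)  = cong suc (trans (length-map suc (elements s)) (length-elements s))
length-elements (false ∷ s) = trans (length-map suc (elements s)) (length-elements s)

∈-elements⁻ : (s : Subset n) {i : Fin n} → i ∈ₗ elements s → i ∈ s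
∈-elements⁻ (true ∷ s)  (here refl) = here
∈-elements⁻ (true ∷ s)  (there p) with _ , q , refl ← ∈-map⁻ suc p = there (∈-elements⁻ s q)
∈-elements⁻ (false ∷ s) p         with _ , q , refl ← ∈-map⁻ suc p = there (∈-elements⁻ s q)

elements-unique : (s : Subset n) → Unique (elements s)
elements-unique []          = []
elements-unique (true ∷ s)  =
  All.map⁺ (All.tabulate λ _ ()) ∷ Unique.map⁺ Fin-suc-injective (elements-unique s)
elements-unique (false ∷ s) = Unique.map⁺ Fin-suc-injective (elements-unique s)

record DistinctMembers₃ (s : Subset n) : Set where
  field
    {a b c}    : Fin n
    a≢b        : a ≢ b
    a≢c        : a ≢ c
    b≢c        : b ≢ c
    a∈         : a ∈ s
    b∈         : b ∈ s
    c∈         : c ∈ s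

distinctMembers₃ : (s : Subset n) → ∣ s ∣ ≡ 3 → DistinctMembers₃ s
distinctMembers₃ s ∣s∣≡3 =
  from-list (elements s) (trans (length-elements s) ∣s∣≡3) (elements-unique s) (∈-elements⁻ s)
  where
    from-list : (is : List (Fin _)) → length is ≡ 3 → Unique is → (∀ {i} → i ∈ₗ is → i ∈ s) → DistinctMembers₃ s
    from-list (a ∷ b ∷ c ∷ []) refl ((a≢b ∷ a≢c ∷ []) ∷ (b≢c ∷ []) ∷ _) ∈s = record
      { a≢b = a≢b ; a≢c = a≢c ; b≢c = b≢c
      ; a∈ = ∈s (here refl) ; b∈ = ∈s (there (here refl)) ; c∈ = ∈s (there (there (here refl))) }

-- The upper bound in (i)

¬¬-∀Fin : ∀ {n} {P : Fin n → Set} → (∀ i → ¬ ¬ P i) → ¬ ¬ (∀ i → P i)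
¬¬-∀Fin {zero}  _   k = k λ ()
¬¬-∀Fin {suc n} ¬¬P k = ¬¬P zero λ p₀ → ¬¬-∀Fin (¬¬P ∘ suc) λ ps → k λ { zero → p₀ ; (suc i) → ps i }

HeavyPair-sym : ∀ {t} {H : Hypergraph3 n} {x y} → HeavyPair t H x y → HeavyPair t H y x
HeavyPair-sym (L , ∣L∣ , !L , L⊆H , ∋xy) = L , ∣L∣ , !L , L⊆H , All.map (λ (x∈ , y∈) → y∈ , x∈) ∋xy

module UpperBound {n : ℕ} (H : Hypergraph3 n) (free : HeavyS2Free 2 H) where

  Light : Fin n → Fin n → Set
  Light x y = ¬ HeavyPair 2 H x y

  heavy-sym : ∀ {x y} → HeavyPair 2 H x y → HeavyPair 2 H y x
  heavy-sym = HeavyPair-sym {t = 2} {H = H}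

  LightPairIn : Subset n → Fin n × Fin n → Set
  LightPairIn e (x , y) = x ∈ e × y ∈ e × Light x y

  light-pair-in-one-edge : ∀ {e e′ x y} → e ∈ₗ edges H → e′ ∈ₗ edges H → e ≢ e′ →
                           LightPairIn e (x , y) → ¬ LightPairIn e′ (x , y)
  light-pair-in-one-edge {e} {e′} e∈H e′∈H e≢e′ (x∈e , y∈e , light) (x∈e′ , y∈e′ , _) =
    light (e ∷ e′ ∷ [] , refl , ((e≢e′ ∷ []) ∷ [] ∷ []) , e∈H ∷ e′∈H ∷ [] , (x∈e , y∈e) ∷ (x∈e′ , y∈e′) ∷ [])

  record LightCorner (e : Subset n) : Set where
    field
      {p q r}   : Fin n
      p≢q       : p ≢ q
      p≢r       : p ≢ r
      q≢r       : q ≢ r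
      p∈        : p ∈ e
      q∈        : q ∈ e
      r∈        : r ∈ e
      light-pr  : Light p r
      light-qr  : Light q r

  cornerPairs : ∀ {e} → LightCorner e → List (Fin n × Fin n)
  cornerPairs c = (p , r) ∷ (r , p) ∷ (q , r) ∷ (r , q) ∷ []
    where open LightCorner c

  cornerPairs-unique : ∀ {e} (c : LightCorner e) → Unique (cornerPairs c)
  cornerPairs-unique c =
    (fst p≢r ∷ fst p≢q ∷ fst p≢r ∷ []) ∷ (fst (q≢r ∘ sym) ∷ snd p≢q ∷ []) ∷ (fst q≢r ∷ []) ∷ [] ∷ []
    where
      open LightCorner c
      fst : ∀ {u v u′ v′ : Fin n} → u ≢ u′ → (u , v) ≢ (u′ , v′)
      fst u≢u′ refl = u≢u′ refl
      snd : ∀ {u v u′ v′ : Fin n} → v ≢ v′ → (u , v) ≢ (u′ , v′)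
      snd v≢v′ refl = v≢v′ refl

  cornerPairs-light : ∀ {e} (c : LightCorner e) → All (LightPairIn e) (cornerPairs c)
  cornerPairs-light c =
    (p∈ , r∈ , light-pr) ∷ (r∈ , p∈ , light-pr ∘ heavy-sym) ∷
    (q∈ , r∈ , light-qr) ∷ (r∈ , q∈ , light-qr ∘ heavy-sym) ∷ []
    where open LightCorner c

  module _ (heavy? : ∀ x y → Dec (HeavyPair 2 H x y)) where

    -- Two heavy sides of a hyperedge share a vertex, so they would form a heavy S₂.
    lightCorner : ∀ {e} → DistinctMembers₃ e → LightCorner e
    lightCorner {e} m = corner (heavy? a b) (heavy? a c)
      where
        open DistinctMembers₃ m
        corner : Dec (HeavyPair 2 H a b) → Dec (HeavyPair 2 H a c) → LightCorner e
        corner (yes ab-heavy) _ = record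
          { p≢q = a≢b ; p≢r = a≢c ; q≢r = b≢c ; p∈ = a∈ ; q∈ = b∈ ; r∈ = c∈
          ; light-pr = λ ac-heavy → free (a , b , c , a≢b , a≢c , b≢c , ab-heavy , ac-heavy)
          ; light-qr = λ bc-heavy → free (b , a , c , a≢b ∘ sym , b≢c , a≢c , heavy-sym ab-heavy , bc-heavy) }
        corner (no ab-light) (yes ac-heavy) = record
          { p≢q = a≢c ; p≢r = a≢b ; q≢r = b≢c ∘ sym ; p∈ = a∈ ; q∈ = c∈ ; r∈ = b∈
          ; light-pr = ab-light
          ; light-qr = λ cb-heavy → free (c , a , b , a≢c ∘ sym , b≢c ∘ sym , a≢b , heavy-sym ac-heavy , cb-heavy) }
        corner (no ab-light) (no ac-light) = record
          { p≢q = b≢c ; p≢r = a≢b ∘ sym ; q≢r = a≢c ∘ sym ; p∈ = b∈ ; q∈ = c∈ ; r∈ = a∈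
          ; light-pr = ab-light ∘ heavy-sym ; light-qr = ac-light ∘ heavy-sym }

    cornerOf : ∀ e → Is3Set e → LightCorner e
    cornerOf e ∣e∣≡3 = lightCorner (distinctMembers₃ e ∣e∣≡3)

    lightPairs : ∀ {es : List (Subset n)} → All Is3Set es → List (Fin n × Fin n)
    lightPairs []                   = []
    lightPairs {e ∷ _} (∣e∣≡3 ∷ 3s) = cornerPairs (cornerOf e ∣e∣≡3) ++ lightPairs 3s

    length-lightPairs : ∀ {es : List (Subset n)} (3s : All Is3Set es) → length (lightPairs 3s) ≡ 4 * length es
    length-lightPairs []                    = refl
    length-lightPairs {e ∷ es} (∣e∣≡3 ∷ 3s) = begin
      length (cornerPairs (cornerOf e ∣e∣≡3) ++ lightPairs 3s) ≡⟨ length-++ (cornerPairs (cornerOf e ∣e∣≡3)) {lightPairs 3s} ⟩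
      4 + length (lightPairs 3s)              ≡⟨ cong (4 +_) (length-lightPairs 3s) ⟩
      4 + 4 * length es                       ≡⟨ *-distribˡ-+ 4 1 (length es) ⟨
      4 * length (e ∷ es)                     ∎
      where open ≡-Reasoning

    ∈-lightPairs⁻ : ∀ {es : List (Subset n)} {xy} (3s : All Is3Set es) → xy ∈ₗ lightPairs 3s → ∃[ e ] e ∈ₗ es × LightPairIn e xy
    ∈-lightPairs⁻ {e ∷ _} (∣e∣≡3 ∷ 3s) xy∈ with ∈-++⁻ (cornerPairs (cornerOf e ∣e∣≡3)) xy∈
    ... | inj₁ xy∈e    = e , here refl , All.lookup (cornerPairs-light (cornerOf e ∣e∣≡3)) xy∈e
    ... | inj₂ xy∈rest with e′ , e′∈ , light ← ∈-lightPairs⁻ 3s xy∈rest = e′ , there e′∈ , light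

    lightPairs-unique : ∀ {es : List (Subset n)} (3s : All Is3Set es) → es ⊆ edges H → Unique es → Unique (lightPairs 3s)
    lightPairs-unique []                   _    _             = []
    lightPairs-unique {e ∷ _} (∣e∣≡3 ∷ 3s) es⊆H (e∉es ∷ !es) =
      Unique.++⁺ (cornerPairs-unique (cornerOf e ∣e∣≡3)) (lightPairs-unique 3s (es⊆H ∘ there) !es) λ (xy∈e , xy∈rest) →
        let e′ , e′∈es , light′ = ∈-lightPairs⁻ 3s xy∈rest in
        light-pair-in-one-edge (es⊆H (here refl)) (es⊆H (there e′∈es)) (All.lookup e∉es e′∈es)
          (All.lookup (cornerPairs-light (cornerOf e ∣e∣≡3)) xy∈e) light′

    4*size≤n*n-dec : 4 * size H ≤ n * n
    4*size≤n*n-dec = begin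
      4 * size H                                  ≡⟨ length-lightPairs (uniform H) ⟨
      length (lightPairs (uniform H))             ≤⟨ Unique-⊆⇒length≤ (lightPairs-unique (uniform H) (λ e∈ → e∈) (distinct H))
                                                       (λ {(x , y)} _ → ∈-cartesianProduct⁺ (∈-allFin x) (∈-allFin y)) ⟩
      length (cartesianProduct (allFin n) (allFin n)) ≡⟨ length-cartesianProduct (allFin n) (allFin n) ⟩
      length (allFin n) * length (allFin n)       ≡⟨ cong₂ _*_ (length-tabulate {n = n} (λ i → i)) (length-tabulate {n = n} (λ i → i)) ⟩
      n * n                                       ∎
      where open ≤-Reasoning

  -- The goal is decidable, so decidability of heaviness may be assumed under a double negation.
  4*size≤n*n : 4 * size H ≤ n * n
  4*size≤n*n = decidable-stable (4 * size H ≤? n * n) λ ¬bound →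
    ¬¬-∀Fin (λ x → ¬¬-∀Fin λ y → ¬¬-excluded-middle) (¬bound ∘ 4*size≤n*n-dec)

-- Matched pairs {2j, 2j+1}

double : ℕ → ℕ
double zero    = zero
double (suc j) = suc (suc (double j))

partner : ℕ → ℕ
partner zero          = 1
partner (suc zero)    = 0
partner (suc (suc x)) = suc (suc (partner x))

double≡2* : ∀ j → double j ≡ 2 * j
double≡2* zero    = refl
double≡2* (suc j) = cong suc (trans (cong suc (double≡2* j)) (sym (+-suc j (j + 0))))

double-injective : ∀ {i j} → double i ≡ double j → i ≡ j
double-injective {zero}  {zero}  _  = refl
double-injective {suc i} {suc j} eq = cong suc (double-injective (suc-injective (suc-injective eq)))

double≢suc-double : ∀ i j → double i ≢ suc (double j)
double≢suc-double zero    _       ()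
double≢suc-double (suc i) (suc j) eq = double≢suc-double i j (suc-injective (suc-injective eq))

double-<-mono : ∀ {i j} → i < j → suc (double i) < double j
double-<-mono {zero}  {suc j} _         = s≤s (s≤s z≤n)
double-<-mono {suc i} {suc j} (s≤s i<j) = s≤s (s≤s (double-<-mono i<j))

double-<-cancel : ∀ {i j} → double i < double j → i < j
double-<-cancel {_}     {zero}  ()
double-<-cancel {zero}  {suc j} _                 = s≤s z≤n
double-<-cancel {suc i} {suc j} (s≤s (s≤s lt)) = s≤s (double-<-cancel lt)

double-+ : ∀ i j → double (i + j) ≡ double i + double j
double-+ zero    j = refl
double-+ (suc i) j = cong (2 +_) (double-+ i j)

*-double : ∀ l j → l * double j ≡ double (l * j)
*-double zero    j = refl
*-double (suc l) j = trans (cong (double j +_) (*-double l j)) (sym (double-+ j (l * j)))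

double+x≡double⇒even : ∀ i x j → double i + x ≡ double j → ∃[ h ] x ≡ double h
double+x≡double⇒even zero    x j       eq = j , eq
double+x≡double⇒even (suc i) x (suc j) eq = double+x≡double⇒even i x j (suc-injective (suc-injective eq))

partner-double : ∀ j → partner (double j) ≡ suc (double j)
partner-double zero    = refl
partner-double (suc j) = cong (2 +_) (partner-double j)

partner-suc-double : ∀ j → partner (suc (double j)) ≡ double j
partner-suc-double zero    = refl
partner-suc-double (suc j) = cong (2 +_) (partner-suc-double j)

InPair : ℕ → ℕ → Set
InPair j u = u ≡ double j ⊎ u ≡ suc (double j)

InPair⇒partner : ∀ {j u v} → InPair j u → InPair j v → u ≢ v → v ≡ partner u
InPair⇒partner {j} (inj₁ refl) (inj₁ refl) u≢v = ⊥-elim (u≢v refl)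
InPair⇒partner {j} (inj₁ refl) (inj₂ refl) _   = sym (partner-double j)
InPair⇒partner {j} (inj₂ refl) (inj₁ refl) _   = sym (partner-suc-double j)
InPair⇒partner {j} (inj₂ refl) (inj₂ refl) u≢v = ⊥-elim (u≢v refl)

InPair⇒triple≡ : ∀ {n j u} x → InPair j u → triple {n} (double j) (suc (double j)) x ≡ triple u (partner u) x
InPair⇒triple≡ {j = j} x (inj₁ refl) = cong (λ w → triple (double j) w x) (sym (partner-double j))
InPair⇒triple≡ {j = j} x (inj₂ refl) =
  trans (triple-swap (double j) _ x) (cong (λ w → triple (suc (double j)) w x) (sym (partner-suc-double j)))

-- A vertex has a single partner, so of two heavy sides at it one is unmatched.
unmatched-light⇒HeavyS2Free : ∀ {t} (H : Hypergraph3 n) →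
  (∀ u v → u ≢ v → toℕ v ≢ partner (toℕ u) → ¬ HeavyPair t H u v) → HeavyS2Free t H
unmatched-light⇒HeavyS2Free H light (u , v , w , u≢v , u≢w , v≢w , uv-heavy , uw-heavy)
  with toℕ v ≟ partner (toℕ u)
... | no  v-unmatched = light u v u≢v v-unmatched uv-heavy
... | yes v-matched   = light u w u≢w (λ w-matched → v≢w (toℕ-injective (trans v-matched (sym w-matched)))) uw-heavy

¬HeavyPair-if-tagged : ∀ {t} (H : Hypergraph3 n) {u v} r → r < t → (Tag : Subset n → ℕ → Set) →
  (∀ {e} → e ∈ₗ edges H → u ∈ e → v ∈ e → ∃[ j ] j < r × Tag e j) →
  (∀ {e e′ j} → Tag e j → Tag e′ j → e ≡ e′) → ¬ HeavyPair t H u v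
¬HeavyPair-if-tagged H r r<t Tag tag tag-injective (L , refl , !L , L⊆H , L∋uv) =
  <⇒≱ r<t (Unique-tagged⇒length≤ r Tag !L
    (All.zipWith (λ (e∈H , u∈e , v∈e) → tag e∈H u∈e v∈e) (L⊆H , L∋uv)) λ _ _ → tag-injective)

module PairEdges {n} (q : ℕ) (X : ℕ → List ℕ) (X-unique : ∀ j → Unique (X j))
                 (X-valid : ∀ {j x} → j < q → x ∈ₗ X j → x < n × x ≢ double j × x ≢ suc (double j))
                 (2q≤n : double q ≤ n) where

  pairEdge : ℕ × ℕ → Subset n
  pairEdge (j , x) = triple (double j) (suc (double j)) x

  keys : List (ℕ × ℕ)
  keys = concatMap (λ j → map (j ,_) (X j)) (downFrom q)

  ValidKey : ℕ × ℕ → Set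
  ValidKey (j , x) = j < q × x ∈ₗ X j

  ∈-keys⁻ : ∀ {k} → k ∈ₗ keys → ValidKey k
  ∈-keys⁻ k∈ with ∈-concatMap⁻′ (λ j → map (j ,_) (X j)) k∈
  ... | j , j∈ , k∈′ with ∈-map⁻ (j ,_) k∈′
  ...   | _ , x∈ , refl = ∈-downFrom⁻ j∈ , x∈

  keys-unique : Unique keys
  keys-unique = Unique-concatMap⁺-indexed _ proj₁ (downFrom⁺ q) (λ j → Unique.map⁺ (λ { refl → refl }) (X-unique j))
    λ k∈ → case ∈-map⁻ _ k∈ of λ { (_ , _ , refl) → refl }

  length-keys : length keys ≡ sum (map (length ∘ X) (downFrom q))
  length-keys = trans (length-concatMap _ (downFrom q)) (cong sum (map-cong (λ j → length-map (j ,_) (X j)) (downFrom q)))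

  pairEdges : List (Subset n)
  pairEdges = map pairEdge keys

  length-pairEdges : length pairEdges ≡ sum (map (length ∘ X) (downFrom q))
  length-pairEdges = trans (length-map pairEdge keys) length-keys

  pair<n : ∀ {j} → j < q → suc (double j) < n
  pair<n j<q = ≤-trans (double-<-mono j<q) 2q≤n

  pairEdge-3set : ∀ {k} → ValidKey k → Is3Set (pairEdge k)
  pairEdge-3set (j<q , x∈) with x<n , x≢2j , x≢2j+1 ← X-valid j<q x∈ =
    ∣triple∣≡3 (<-trans (n<1+n _) (pair<n j<q)) (pair<n j<q) x<n (λ eq → 1+n≢n (sym eq)) (x≢2j ∘ sym) (x≢2j+1 ∘ sym)

  pairEdge-injective : ∀ {k k′} → ValidKey k → ValidKey k′ → pairEdge k ≡ pairEdge k′ → k ≡ k′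
  pairEdge-injective {j , x} {j′ , x′} (j<q , x∈) _ eq = cong₂ _,_ same-pair same-third
    where
      x<n = proj₁ (X-valid j<q x∈)
      same-pair : j ≡ j′
      same-pair with triple-≡⇒OneOf₃ eq (pair<n j<q) (inj₂ (inj₁ refl))
      ... | inj₁ odd≡even      = ⊥-elim (double≢suc-double j′ j (sym odd≡even))
      ... | inj₂ (inj₁ eq′)    = double-injective (suc-injective eq′)
      ... | inj₂ (inj₂ 2j+1≡x′) with triple-≡⇒OneOf₃ eq (<-trans (n<1+n _) (pair<n j<q)) (inj₁ refl)
      ...   | inj₁ eq′          = double-injective eq′
      ...   | inj₂ (inj₁ even≡odd) = ⊥-elim (double≢suc-double j j′ even≡odd)
      ...   | inj₂ (inj₂ 2j≡x′) = ⊥-elim (1+n≢n (trans 2j+1≡x′ (sym 2j≡x′)))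
      same-third : x ≡ x′
      same-third with same-pair | triple-≡⇒OneOf₃ eq x<n (inj₂ (inj₂ refl))
      ... | refl | inj₁ x≡2j          = ⊥-elim (proj₁ (proj₂ (X-valid j<q x∈)) x≡2j)
      ... | refl | inj₂ (inj₁ x≡2j+1) = ⊥-elim (proj₂ (proj₂ (X-valid j<q x∈)) x≡2j+1)
      ... | refl | inj₂ (inj₂ x≡x′)   = x≡x′

  pairEdges-3sets : All Is3Set pairEdges
  pairEdges-3sets = All.map⁺ (All.tabulate (pairEdge-3set ∘ ∈-keys⁻))

  pairEdges-unique : Unique pairEdges
  pairEdges-unique = Unique-map⁺ pairEdge keys-unique λ k∈ k′∈ → pairEdge-injective (∈-keys⁻ k∈) (∈-keys⁻ k′∈)

  Through : ℕ → ℕ → Subset n → Set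
  Through u v e = ∃[ j ] InPair j u × v ∈ₗ X j × e ≡ triple u (partner u) v

  pairEdge-through : ∀ {e} {u v : Fin n} → e ∈ₗ pairEdges → u ∈ e → v ∈ e → u ≢ v → toℕ v ≢ partner (toℕ u) →
                     Through (toℕ u) (toℕ v) e ⊎ Through (toℕ v) (toℕ u) e
  pairEdge-through {u = u} {v} e∈ u∈e v∈e u≢v unmatched with ∈-map⁻ pairEdge e∈
  ... | (j , x) , k∈ , refl with ∈-keys⁻ k∈
  ...   | _ , x∈ = classify (pair-or-third (∈-triple⁻ u u∈e)) (pair-or-third (∈-triple⁻ v v∈e))
    where
      U≢V : toℕ u ≢ toℕ v
      U≢V = u≢v ∘ toℕ-injective
      pair-or-third : ∀ {w} → OneOf₃ w (double j) (suc (double j)) x → InPair j w ⊎ w ≡ x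
      pair-or-third (inj₁ w≡2j)          = inj₁ (inj₁ w≡2j)
      pair-or-third (inj₂ (inj₁ w≡2j+1)) = inj₁ (inj₂ w≡2j+1)
      pair-or-third (inj₂ (inj₂ w≡x))    = inj₂ w≡x
      classify : InPair j (toℕ u) ⊎ toℕ u ≡ x → InPair j (toℕ v) ⊎ toℕ v ≡ x →
                 Through (toℕ u) (toℕ v) (pairEdge (j , x)) ⊎ Through (toℕ v) (toℕ u) (pairEdge (j , x))
      classify (inj₁ u-pair) (inj₁ v-pair) = ⊥-elim (unmatched (InPair⇒partner u-pair v-pair U≢V))
      classify (inj₁ u-pair) (inj₂ refl)   = inj₁ (j , u-pair , x∈ , InPair⇒triple≡ x u-pair)
      classify (inj₂ refl)   (inj₁ v-pair) = inj₂ (j , v-pair , x∈ , InPair⇒triple≡ x v-pair)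
      classify (inj₂ u≡x)    (inj₂ v≡x)    = ⊥-elim (U≢V (trans u≡x (sym v≡x)))

-- The construction for (i)

module MatchingConstruction {n} (q : ℕ) (2q≤n : double q ≤ n) where

  below : ℕ → List ℕ
  below j = downFrom (double j)

  below-valid : ∀ {j x} → j < q → x ∈ₗ below j → x < n × x ≢ double j × x ≢ suc (double j)
  below-valid j<q x∈ =
    let x<2j = ∈-downFrom⁻ x∈ in
    <-trans x<2j (<-trans (n<1+n _) (≤-trans (double-<-mono j<q) 2q≤n)) , <⇒≢ x<2j , <⇒≢ (m<n⇒m<1+n x<2j)

  open PairEdges q below (downFrom⁺ ∘ double) below-valid 2q≤n

  H : Hypergraph3 n
  H = record { edges = pairEdges ; uniform = pairEdges-3sets ; distinct = pairEdges-unique }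

  size-H : size H + q ≡ q * q
  size-H = trans (cong (_+ q) length-pairEdges) (count q)
    where
      count : ∀ p → sum (map (length ∘ below) (downFrom p)) + p ≡ p * p
      count zero    = refl
      count (suc p) = begin
        length (below p) + S + suc p ≡⟨ cong (λ c → c + S + suc p) (trans (length-downFrom (double p)) (double≡2* p)) ⟩
        2 * p + S + suc p            ≡⟨ regroup p S ⟩
        suc (2 * p + (S + p))        ≡⟨ cong (λ c → suc (2 * p + c)) (count p) ⟩
        suc (2 * p + p * p)          ≡⟨ square p ⟩
        suc p * suc p                ∎
        where
          open ≡-Reasoning
          S = sum (map (length ∘ below) (downFrom p))
          regroup : ∀ p S → 2 * p + S + suc p ≡ suc (2 * p + (S + p))
          regroup = solve-∀
          square : ∀ p → suc (2 * p + p * p) ≡ suc p * suc p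
          square = solve-∀

  Through⇒> : ∀ {u v e} → Through u v e → v < u
  Through⇒> (j , inj₁ refl , v∈ , _) = ∈-downFrom⁻ v∈
  Through⇒> (j , inj₂ refl , v∈ , _) = m<n⇒m<1+n (∈-downFrom⁻ v∈)

  H-free : HeavyS2Free 2 H
  H-free = unmatched-light⇒HeavyS2Free H λ u v u≢v unmatched →
    ¬HeavyPair-if-tagged H 1 ≤-refl (λ e _ → Through (toℕ u) (toℕ v) e ⊎ Through (toℕ v) (toℕ u) e)
      (λ e∈ u∈e v∈e → 0 , s≤s z≤n , pairEdge-through e∈ u∈e v∈e u≢v unmatched) one-edge
    where
      one-edge : ∀ {u v e e′} → Through u v e ⊎ Through v u e → Through u v e′ ⊎ Through v u e′ → e ≡ e′
      one-edge (inj₁ (_ , _ , _ , refl)) (inj₁ (_ , _ , _ , refl)) = refl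
      one-edge (inj₂ (_ , _ , _ , refl)) (inj₂ (_ , _ , _ , refl)) = refl
      one-edge (inj₁ uv) (inj₂ vu) = ⊥-elim (<-asym (Through⇒> uv) (Through⇒> vu))
      one-edge (inj₂ vu) (inj₁ uv) = ⊥-elim (<-asym (Through⇒> uv) (Through⇒> vu))

-- The construction for (ii)

[r+d]%m≡r⇒d≡0 : ∀ m .{{_ : NonZero m}} r d → r < m → d < m → (r + d) % m ≡ r → d ≡ 0
[r+d]%m≡r⇒d≡0 m r d r<m d<m eq with <-cmp (r + d) m
... | tri< r+d<m _ _ = +-cancelˡ-≡ r d 0 (trans (sym (m<n⇒m%n≡m r+d<m)) (trans eq (sym (+-identityʳ r))))
... | tri≈ _ r+d≡m _ = ⊥-elim (<⇒≢ d<m (trans (sym (cong (_+ d) r≡0)) r+d≡m))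
  where r≡0 = trans (sym eq) (trans (cong (_% m) r+d≡m) (n%n≡0 m))
... | tri> _ _ r+d>m = ⊥-elim (<⇒≢ d<m (+-cancelˡ-≡ r d m (begin
  r + d           ≡⟨ m∸n+n≡m (<⇒≤ r+d>m) ⟨
  r + d ∸ m + m   ≡⟨ cong (_+ m) wrapped ⟩
  r + m           ∎)))
  where
    open ≡-Reasoning
    wrapped : r + d ∸ m ≡ r
    wrapped = trans (sym (m<n⇒m%n≡m (+-cancelʳ-< _ _ m (subst (_< m + m) (sym (m∸n+n≡m (<⇒≤ r+d>m))) (+-mono-< r<m d<m)))))
                    (trans (m≤n⇒[n∸m]%m≡n%m (<⇒≤ r+d>m)) eq)

+-cancelˡ-%-≤ : ∀ m .{{_ : NonZero m}} x {b b′} → b ≤ b′ → b′ < m → (x + b) % m ≡ (x + b′) % m → b ≡ b′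
+-cancelˡ-%-≤ m x {b} {b′} b≤b′ b′<m eq = begin
  b           ≡⟨ +-identityʳ b ⟨
  b + 0       ≡⟨ cong (b +_) d≡0 ⟨
  b + (b′ ∸ b) ≡⟨ m+[n∸m]≡n b≤b′ ⟩
  b′          ∎
  where
    open ≡-Reasoning
    d<m = ≤-<-trans (m∸n≤m b′ b) b′<m
    d≡0 : b′ ∸ b ≡ 0
    d≡0 = [r+d]%m≡r⇒d≡0 m ((x + b) % m) (b′ ∸ b) (m%n<n (x + b) m) d<m (begin
      ((x + b) % m + (b′ ∸ b)) % m       ≡⟨ cong (λ d → ((x + b) % m + d) % m) (m<n⇒m%n≡m d<m) ⟨
      ((x + b) % m + (b′ ∸ b) % m) % m   ≡⟨ %-distribˡ-+ (x + b) (b′ ∸ b) m ⟨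
      (x + b + (b′ ∸ b)) % m             ≡⟨ cong (_% m) (+-assoc x b (b′ ∸ b)) ⟩
      (x + (b + (b′ ∸ b))) % m           ≡⟨ cong (λ c → (x + c) % m) (m+[n∸m]≡n b≤b′) ⟩
      (x + b′) % m                       ≡⟨ eq ⟨
      (x + b) % m                        ∎)

+-cancelˡ-% : ∀ m .{{_ : NonZero m}} x {b b′} → b < m → b′ < m → (x + b) % m ≡ (x + b′) % m → b ≡ b′
+-cancelˡ-% m x {b} {b′} b<m b′<m eq with ≤-total b b′
... | inj₁ b≤b′ = +-cancelˡ-%-≤ m x b≤b′ b′<m eq
... | inj₂ b′≤b = sym (+-cancelˡ-%-≤ m x b′≤b b<m (sym eq))

next : ℕ → ℕ
next 0 = 1
next 1 = 2
next _ = 0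

next-≢ : ∀ l → next l ≢ l
next-≢ 0 ()
next-≢ 1 ()
next-≢ (suc (suc l)) ()

next²-≢ : ∀ l → next (next l) ≢ l
next²-≢ 0 ()
next²-≢ 1 ()
next²-≢ 2 ()
next²-≢ (suc (suc (suc l))) ()

next<3 : ∀ l → next l < 3
next<3 0 = s≤s (s≤s z≤n)
next<3 1 = s≤s (s≤s (s≤s z≤n))
next<3 (suc (suc l)) = s≤s z≤n

OneOf₂ : ℕ → ℕ → ℕ → Set
OneOf₂ x a b = x ≡ a ⊎ x ≡ b

OneOf₂-< : ∀ {x a b m} → OneOf₂ x a b → a < m → b < m → x < m
OneOf₂-< (inj₁ refl) a<m _   = a<m
OneOf₂-< (inj₂ refl) _   b<m = b<m

same-ordered-pair : ∀ {x y a b a′ b′} → a < b → a′ < b′ → x ≢ y → OneOf₂ x a b → OneOf₂ y a b →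
                    OneOf₂ x a′ b′ → OneOf₂ y a′ b′ → a ≡ a′ × b ≡ b′
same-ordered-pair a<b a′<b′ x≢y (inj₁ refl) (inj₁ refl) _ _ = ⊥-elim (x≢y refl)
same-ordered-pair a<b a′<b′ x≢y (inj₂ refl) (inj₂ refl) _ _ = ⊥-elim (x≢y refl)
same-ordered-pair a<b a′<b′ x≢y _ _ (inj₁ refl) (inj₁ refl) = ⊥-elim (x≢y refl)
same-ordered-pair a<b a′<b′ x≢y _ _ (inj₂ refl) (inj₂ refl) = ⊥-elim (x≢y refl)
same-ordered-pair a<b a′<b′ x≢y (inj₁ refl) (inj₂ refl) (inj₁ refl) (inj₂ refl) = refl , refl
same-ordered-pair a<b a′<b′ x≢y (inj₂ refl) (inj₁ refl) (inj₂ refl) (inj₁ refl) = refl , refl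
same-ordered-pair a<b a′<b′ x≢y (inj₁ refl) (inj₂ refl) (inj₂ refl) (inj₁ refl) = ⊥-elim (<-asym a<b a′<b′)
same-ordered-pair a<b a′<b′ x≢y (inj₂ refl) (inj₁ refl) (inj₁ refl) (inj₂ refl) = ⊥-elim (<-asym a<b a′<b′)

record Complement (x a b : ℕ) : Set where
  field
    other    : ℕ
    other∈   : OneOf₂ other a b
    sum≡     : a + b ≡ x + other
    distinct : a < b → x ≢ other

complement : ∀ {x a b} → OneOf₂ x a b → Complement x a b
complement {a = a} {b} (inj₁ refl) = record { other∈ = inj₂ refl ; sum≡ = refl ; distinct = <⇒≢ }
complement {a = a} {b} (inj₂ refl) = record { other∈ = inj₁ refl ; sum≡ = +-comm a b ; distinct = λ a<b → <⇒≢ a<b ∘ sym }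

record CyclicKey : Set where
  constructor key
  field
    shift level lo hi : ℕ

module CyclicConstruction {n} (q′ t′ : ℕ) (M≤n : double (3 * suc q′) ≤ n) (t′≤m : t′ ≤ double (suc q′)) where

  q m M : ℕ
  q = suc q′
  m = double q
  M = double (3 * q)

  M≡3*m : M ≡ 3 * m
  M≡3*m = sym (*-double 3 q)

  opaque
    vertex : ℕ → ℕ → ℕ
    vertex l α = l * m + α

    vertex-injective : ∀ {l l′ α α′} → vertex l α ≡ vertex l′ α′ → α < m → α′ < m → l ≡ l′ × α ≡ α′
    vertex-injective {zero}  {zero}  eq _ _ = refl , eq
    vertex-injective {zero}  {suc l′} {α} {α′} eq α<m _ =
      ⊥-elim (<⇒≱ α<m (subst (m ≤_) (sym eq) (≤-trans (m≤m+n m (l′ * m)) (m≤m+n _ α′))))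
    vertex-injective {suc l} {zero}  {α} {α′} eq _ α′<m =
      ⊥-elim (<⇒≱ α′<m (subst (m ≤_) eq (≤-trans (m≤m+n m (l * m)) (m≤m+n _ α))))
    vertex-injective {suc l} {suc l′} {α} {α′} eq α<m α′<m
      with l≡l′ , α≡α′ ← vertex-injective {l} {l′}
             (+-cancelˡ-≡ m _ _ (trans (sym (+-assoc m (l * m) α)) (trans eq (+-assoc m (l′ * m) α′)))) α<m α′<m
      = cong suc l≡l′ , α≡α′

    vertex-<M : ∀ {l α} → l < 3 → α < m → vertex l α < M
    vertex-<M {l} {α} l<3 α<m = subst (vertex l α <_) (sym M≡3*m)
      (≤-trans (+-monoʳ-< (l * m) α<m) (subst (_≤ 3 * m) (+-comm m (l * m)) (*-monoˡ-≤ m l<3)))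

    vertex-suc : ∀ l α → vertex l (suc α) ≡ suc (vertex l α)
    vertex-suc l α = +-suc (l * m) α

    vertex≡double+ : ∀ l α → vertex l α ≡ double (l * q) + α
    vertex≡double+ l α = cong (_+ α) (*-double l q)

    vertex-cancel : ∀ {l α β} → vertex l α ≡ vertex l β → α ≡ β
    vertex-cancel {l} = +-cancelˡ-≡ (l * m) _ _

  <M⇒<n : ∀ {x} → x < M → x < n
  <M⇒<n x<M = ≤-trans x<M M≤n

  vertex-<n : ∀ {l α} → l < 3 → α < m → vertex l α < n
  vertex-<n l<3 α<m = <M⇒<n (vertex-<M l<3 α<m)

  pair<M : ∀ {j} → j < 3 * q → suc (double j) < M
  pair<M = double-<-mono

  others : ℕ → List ℕ
  others j = downFrom (double j) ++ map (2 + double j +_) (downFrom (M ∸ (2 + double j)))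

  others-valid : ∀ {j x} → j < 3 * q → x ∈ₗ others j → x < n × x ≢ double j × x ≢ suc (double j)
  others-valid {j} j<3q x∈ with ∈-++⁻ (downFrom (double j)) x∈
  ... | inj₁ x∈below = let x<2j = ∈-downFrom⁻ x∈below in
    <M⇒<n (<-trans x<2j (<-trans (n<1+n _) (pair<M j<3q))) , <⇒≢ x<2j , <⇒≢ (m<n⇒m<1+n x<2j)
  ... | inj₂ x∈above with d , d∈ , refl ← ∈-map⁻ (2 + double j +_) x∈above =
    <M⇒<n (subst (2 + double j + d <_) (m+[n∸m]≡n (pair<M j<3q)) (+-monoʳ-< (2 + double j) (∈-downFrom⁻ d∈))) ,
    (λ eq → <⇒≢ (m<n⇒m<1+n (s≤s (m≤m+n (double j) d))) (sym eq)) ,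
    (λ eq → <⇒≢ (s≤s (s≤s (m≤m+n (double j) d))) (sym eq))

  others-unique : ∀ j → Unique (others j)
  others-unique j = Unique.++⁺ (downFrom⁺ (double j)) (Unique.map⁺ (+-cancelˡ-≡ (2 + double j) _ _) (downFrom⁺ _))
    λ (x∈below , x∈above) → case ∈-map⁻ (2 + double j +_) x∈above of λ where
      (d , _ , refl) → <⇒≱ (∈-downFrom⁻ x∈below) (m≤n⇒m≤1+n (m≤n⇒m≤1+n (m≤m+n (double j) d)))

  length-others : ∀ {j} → j < 3 * q → length (others j) ≡ M ∸ 2
  length-others {j} j<3q = begin
    length (others j)                                 ≡⟨ length-++ (downFrom (double j)) ⟩
    length (downFrom (double j)) + length (map (2 + double j +_) (downFrom (M ∸ (2 + double j))))
      ≡⟨ cong₂ _+_ (length-downFrom (double j)) (trans (length-map (2 + double j +_) (downFrom (M ∸ (2 + double j)))) (length-downFrom (M ∸ (2 + double j)))) ⟩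
    double j + (M ∸ (2 + double j))                   ≡⟨ +-∸-assoc (double j) (pair<M j<3q) ⟨
    double j + M ∸ (2 + double j)                     ≡⟨ cong (double j + M ∸_) (+-comm 2 (double j)) ⟩
    double j + M ∸ (double j + 2)                     ≡⟨ [m+n]∸[m+o]≡n∸o (double j) M 2 ⟩
    M ∸ 2                                             ∎
    where open ≡-Reasoning

  open PairEdges (3 * q) others others-unique others-valid M≤n

  apex : ℕ → ℕ → ℕ → ℕ
  apex s a b = (a + b + s) % m

  apex-<m : ∀ s a b → apex s a b < m
  apex-<m s a b = m%n<n (a + b + s) m

  cyclicEdge : CyclicKey → Subset n
  cyclicEdge (key s l a b) = triple (vertex l a) (vertex l b) (vertex (next l) (apex s a b))

  ValidCyclicKey : CyclicKey → Set
  ValidCyclicKey (key s l a b) = s < t′ × l < 3 × suc a < b × b < m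

  keysBelow : ℕ → ℕ → ℕ → List CyclicKey
  keysBelow s l b = map (λ a → key s l a b) (downFrom (b ∸ 1))

  levelKeys : ℕ → ℕ → List CyclicKey
  levelKeys s l = concatMap (keysBelow s l) (downFrom m)

  shiftKeys : ℕ → List CyclicKey
  shiftKeys s = concatMap (levelKeys s) (downFrom 3)

  cyclicKeys : List CyclicKey
  cyclicKeys = concatMap shiftKeys (downFrom t′)

  ∈-keysBelow⁻ : ∀ {s l b k} → k ∈ₗ keysBelow s l b → ∃[ a ] suc a < b × k ≡ key s l a b
  ∈-keysBelow⁻ {b = b} k∈ with a , a∈ , refl ← ∈-map⁻ _ k∈ = a , a+1<b b (∈-downFrom⁻ a∈) , refl
    where
      a+1<b : ∀ b {a} → a < b ∸ 1 → suc a < b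
      a+1<b (suc b) a<b = s≤s a<b

  ∈-levelKeys⁻ : ∀ {s l k} → k ∈ₗ levelKeys s l → ∃[ a ] ∃[ b ] suc a < b × b < m × k ≡ key s l a b
  ∈-levelKeys⁻ {s} {l} k∈ with ∈-concatMap⁻′ (keysBelow s l) k∈
  ... | b , b∈ , k∈′ with ∈-keysBelow⁻ k∈′
  ...   | a , a+1<b , refl = a , b , a+1<b , ∈-downFrom⁻ b∈ , refl

  ∈-shiftKeys⁻ : ∀ {s k} → k ∈ₗ shiftKeys s → ∃[ l ] ∃[ a ] ∃[ b ] l < 3 × suc a < b × b < m × k ≡ key s l a b
  ∈-shiftKeys⁻ {s} k∈ with ∈-concatMap⁻′ (levelKeys s) k∈
  ... | l , l∈ , k∈′ with ∈-levelKeys⁻ k∈′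
  ...   | a , b , a+1<b , b<m , refl = l , a , b , ∈-downFrom⁻ l∈ , a+1<b , b<m , refl

  ∈-cyclicKeys⁻ : ∀ {k} → k ∈ₗ cyclicKeys → ValidCyclicKey k
  ∈-cyclicKeys⁻ k∈ with ∈-concatMap⁻′ shiftKeys k∈
  ... | s , s∈ , k∈′ with ∈-shiftKeys⁻ k∈′
  ...   | _ , _ , _ , l<3 , a+1<b , b<m , refl = ∈-downFrom⁻ s∈ , l<3 , a+1<b , b<m

  cyclicKeys-unique : Unique cyclicKeys
  cyclicKeys-unique =
    Unique-concatMap⁺-indexed shiftKeys CyclicKey.shift (downFrom⁺ t′) (λ s →
      Unique-concatMap⁺-indexed (levelKeys s) CyclicKey.level (downFrom⁺ 3) (λ l →
        Unique-concatMap⁺-indexed (keysBelow s l) CyclicKey.hi (downFrom⁺ m)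
          (λ b → Unique.map⁺ (λ { refl → refl }) (downFrom⁺ (b ∸ 1)))
          λ k∈ → case ∈-keysBelow⁻ k∈ of λ { (_ , _ , refl) → refl })
        λ k∈ → case ∈-levelKeys⁻ k∈ of λ { (_ , _ , _ , _ , refl) → refl })
      λ k∈ → case ∈-shiftKeys⁻ k∈ of λ { (_ , _ , _ , _ , _ , _ , refl) → refl }

  T : ℕ
  T = sum (map (_∸ 1) (downFrom m))

  length-cyclicKeys : length cyclicKeys ≡ t′ * (3 * T)
  length-cyclicKeys = trans (length-concatMap shiftKeys (downFrom t′))
    (trans (sum-map-const _ (downFrom t′) (λ {s} _ → length-shiftKeys s)) (cong (_* (3 * T)) (length-downFrom t′)))
    where
      length-levelKeys : ∀ s l → length (levelKeys s l) ≡ T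
      length-levelKeys s l = trans (length-concatMap (keysBelow s l) (downFrom m))
        (cong sum (map-cong (λ b → trans (length-map _ (downFrom (b ∸ 1))) (length-downFrom (b ∸ 1))) (downFrom m)))
      length-shiftKeys : ∀ s → length (shiftKeys s) ≡ 3 * T
      length-shiftKeys s = trans (length-concatMap (levelKeys s) (downFrom 3))
        (sum-map-const _ (downFrom 3) λ {l} _ → length-levelKeys s l)

  open CyclicKey

  OnEdge : ℕ → CyclicKey → Set
  OnEdge w k = OneOf₃ w (vertex (level k) (lo k)) (vertex (level k) (hi k)) (vertex (next (level k)) (apex (shift k) (lo k) (hi k)))

  data Position (w : ℕ) (k : CyclicKey) : Set where
    base : ∀ {α} → OneOf₂ α (lo k) (hi k) → w ≡ vertex (level k) α → Position w k
    top  : w ≡ vertex (next (level k)) (apex (shift k) (lo k) (hi k)) → Position w k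

  position : ∀ {w k} → OnEdge w k → Position w k
  position (inj₁ w≡)        = base (inj₁ refl) w≡
  position (inj₂ (inj₁ w≡)) = base (inj₂ refl) w≡
  position (inj₂ (inj₂ w≡)) = top w≡

  module _ {k : CyclicKey} (valid : ValidCyclicKey k) where

    lo<hi : lo k < hi k
    lo<hi = <⇒≤ (proj₁ (proj₂ (proj₂ valid)))

    hi<m : hi k < m
    hi<m = proj₂ (proj₂ (proj₂ valid))

    base<m : ∀ {α} → OneOf₂ α (lo k) (hi k) → α < m
    base<m α∈ = OneOf₂-< α∈ (<-trans lo<hi hi<m) hi<m

    top<m : apex (shift k) (lo k) (hi k) < m
    top<m = apex-<m (shift k) (lo k) (hi k)

    shift<m : shift k < m
    shift<m = <-≤-trans (proj₁ valid) t′≤m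

    OnEdge-<n : ∀ {w} → OnEdge w k → w < n
    OnEdge-<n w-on with position w-on
    ... | base α∈ refl = vertex-<n (proj₁ (proj₂ valid)) (base<m α∈)
    ... | top refl     = vertex-<n (next<3 (level k)) top<m

    base-pair-on-edge : ∀ {l x y} → x < m → y < m → x ≢ y →
      OnEdge (vertex l x) k → OnEdge (vertex l y) k → level k ≡ l × OneOf₂ x (lo k) (hi k) × OneOf₂ y (lo k) (hi k)
    base-pair-on-edge x<m y<m x≢y x-on y-on with position x-on | position y-on
    ... | base α∈ eqx | base β∈ eqy with vertex-injective eqx x<m (base<m α∈) | vertex-injective eqy y<m (base<m β∈)
    ...   | refl , refl | _ , refl = refl , α∈ , β∈
    base-pair-on-edge x<m y<m x≢y x-on y-on | base α∈ eqx | top eqy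
      with vertex-injective eqx x<m (base<m α∈) | vertex-injective eqy y<m top<m
    ...   | refl , _ | l≡next , _ = ⊥-elim (next-≢ _ (sym l≡next))
    base-pair-on-edge x<m y<m x≢y x-on y-on | top eqx | base β∈ eqy
      with vertex-injective eqx x<m top<m | vertex-injective eqy y<m (base<m β∈)
    ...   | l≡next , _ | refl , _ = ⊥-elim (next-≢ _ (sym l≡next))
    base-pair-on-edge x<m y<m x≢y x-on y-on | top eqx | top eqy = ⊥-elim (x≢y (vertex-cancel (trans eqx (sym eqy))))

    base-top-on-edge : ∀ {l x z} → x < m → z < m →
      OnEdge (vertex l x) k → OnEdge (vertex (next l) z) k →
      level k ≡ l × OneOf₂ x (lo k) (hi k) × z ≡ apex (shift k) (lo k) (hi k)
    base-top-on-edge x<m z<m x-on z-on with position x-on | position z-on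
    ... | base α∈ eqx | base β∈ eqz with vertex-injective eqx x<m (base<m α∈) | vertex-injective eqz z<m (base<m β∈)
    ...   | refl , _ | next≡ , _ = ⊥-elim (next-≢ _ next≡)
    base-top-on-edge x<m z<m x-on z-on | base α∈ eqx | top eqz
      with vertex-injective eqx x<m (base<m α∈) | vertex-injective eqz z<m top<m
    ...   | refl , refl | _ , z≡ = refl , α∈ , z≡
    base-top-on-edge x<m z<m x-on z-on | top eqx | base β∈ eqz
      with vertex-injective eqx x<m top<m | vertex-injective eqz z<m (base<m β∈)
    ...   | refl , _ | next²≡ , _ = ⊥-elim (next²-≢ _ next²≡)
    base-top-on-edge x<m z<m x-on z-on | top eqx | top eqz
      with vertex-injective eqx x<m top<m | vertex-injective eqz z<m top<m
    ...   | refl , _ | next≡ , _ = ⊥-elim (next-≢ _ next≡)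

  key-≡ : ∀ {k k′} → shift k ≡ shift k′ → level k ≡ level k′ → lo k ≡ lo k′ → hi k ≡ hi k′ → k ≡ k′
  key-≡ refl refl refl refl = refl

  module _ {k k′ : CyclicKey} (valid : ValidCyclicKey k) (valid′ : ValidCyclicKey k′) where

    shared-base-pair : ∀ {α β} → α ≢ β → OneOf₂ α (lo k) (hi k) → OneOf₂ β (lo k) (hi k) →
      OnEdge (vertex (level k) α) k′ → OnEdge (vertex (level k) β) k′ → level k′ ≡ level k × lo k ≡ lo k′ × hi k ≡ hi k′
    shared-base-pair α≢β α∈ β∈ α-on′ β-on′
      with level≡ , α∈′ , β∈′ ← base-pair-on-edge valid′ (base<m valid α∈) (base<m valid β∈) α≢β α-on′ β-on′ =
      level≡ , same-ordered-pair (lo<hi valid) (lo<hi valid′) α≢β α∈ β∈ α∈′ β∈′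

    -- The apex determines the sum lo + hi modulo m, hence the second base vertex.
    shared-base-top : shift k ≡ shift k′ → ∀ {α} → OneOf₂ α (lo k) (hi k) →
      OnEdge (vertex (level k) α) k′ → OnEdge (vertex (next (level k)) (apex (shift k) (lo k) (hi k))) k′ → k ≡ k′
    shared-base-top refl {α} α∈ α-on′ top-on′
      with refl , α∈′ , apex≡ ← base-top-on-edge valid′ (base<m valid α∈) (top<m valid) α-on′ top-on′ =
      key-≡ refl refl (proj₁ lo≡×hi≡) (proj₂ lo≡×hi≡)
      where
        c  = complement α∈
        c′ = complement α∈′
        open Complement
        s = shift k
        rearranged : ∀ a b {o} → a + b ≡ α + o → (a + b + s) % m ≡ (α + s + o) % m
        rearranged a b {o} eq = cong (_% m) (trans (cong (_+ s) eq) (trans (+-assoc α o s) (trans (cong (α +_) (+-comm o s)) (sym (+-assoc α s o)))))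
        other≡ : other c ≡ other c′
        other≡ = +-cancelˡ-% m (α + s) (base<m valid (other∈ c)) (base<m valid′ (other∈ c′))
          (trans (sym (rearranged (lo k) (hi k) (sum≡ c))) (trans apex≡ (rearranged (lo k′) (hi k′) (sum≡ c′))))
        lo≡×hi≡ : lo k ≡ lo k′ × hi k ≡ hi k′
        lo≡×hi≡ = same-ordered-pair (lo<hi valid) (lo<hi valid′) (distinct c (lo<hi valid)) α∈ (other∈ c) α∈′
                    (subst (λ o → OneOf₂ o _ _) (sym other≡) (other∈ c′))

    shared-pair⇒same-key : shift k ≡ shift k′ → ∀ {U V} → U ≢ V →
      OnEdge U k → OnEdge V k → OnEdge U k′ → OnEdge V k′ → k ≡ k′
    shared-pair⇒same-key s≡ U≢V U-on V-on U-on′ V-on′ with position U-on | position V-on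
    ... | base α∈ refl | base β∈ refl with level≡ , lo≡ , hi≡ ← shared-base-pair (U≢V ∘ cong (vertex _)) α∈ β∈ U-on′ V-on′ =
      key-≡ s≡ (sym level≡) lo≡ hi≡
    ... | base α∈ refl | top refl     = shared-base-top s≡ α∈ U-on′ V-on′
    ... | top refl     | base β∈ refl = shared-base-top s≡ β∈ V-on′ U-on′
    ... | top refl     | top refl     = ⊥-elim (U≢V refl)

    OnEdge-transport : cyclicEdge k ≡ cyclicEdge k′ → ∀ {w} → OnEdge w k → OnEdge w k′
    OnEdge-transport eq w-on = triple-≡⇒OneOf₃ eq (OnEdge-<n valid w-on) w-on

    cyclicEdge-injective : cyclicEdge k ≡ cyclicEdge k′ → k ≡ k′
    cyclicEdge-injective eq
      with level≡ , lo≡ , hi≡ ← shared-base-pair (<⇒≢ (lo<hi valid)) (inj₁ refl) (inj₂ refl)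
                                  (OnEdge-transport eq (inj₁ refl)) (OnEdge-transport eq (inj₂ (inj₁ refl)))
      with position (OnEdge-transport eq (inj₂ (inj₂ refl)))
    ... | base β∈ top≡ = ⊥-elim (next-≢ (level k) (trans (proj₁ (vertex-injective top≡ (top<m valid) (base<m valid′ β∈))) level≡))
    ... | top top≡     = key-≡ shift≡ (sym level≡) lo≡ hi≡
      where
        shift≡ : shift k ≡ shift k′
        shift≡ = +-cancelˡ-% m (lo k + hi k) (shift<m valid) (shift<m valid′)
          (trans (proj₂ (vertex-injective top≡ (top<m valid) (top<m valid′))) (cong₂ (λ a b → (a + b + shift k′) % m) (sym lo≡) (sym hi≡)))

  -- Levels have even length, so a matched pair never straddles two of them.
  matched-in-one-level : ∀ {l l′ α β j} → α < m → β < m → vertex l α ≡ double j → vertex l′ β ≡ suc (double j) →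
                         l ≡ l′ × suc α ≡ β
  matched-in-one-level {l} {l′} {α} {β} {j} α<m β<m 2j≡ 2j+1≡
    with h , refl ← double+x≡double⇒even (l * q) α j (trans (sym (vertex≡double+ l α)) 2j≡) =
    vertex-injective (trans (vertex-suc l α) (trans (cong suc 2j≡) (sym 2j+1≡)))
      (double-<-mono (double-<-cancel α<m)) β<m

  cyclicEdge-unmatched : ∀ {k j} → ValidCyclicKey k → OnEdge (double j) k → ¬ OnEdge (suc (double j)) k
  cyclicEdge-unmatched {k} valid 2j-on 2j+1-on with position 2j-on | position 2j+1-on
  ... | base α∈ eqα | base β∈ eqβ =
        not-consecutive α∈ β∈ (proj₂ (matched-in-one-level (base<m valid α∈) (base<m valid β∈) (sym eqα) (sym eqβ)))
    where
      a+1<b = proj₁ (proj₂ (proj₂ valid))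
      not-consecutive : ∀ {α β} → OneOf₂ α (lo k) (hi k) → OneOf₂ β (lo k) (hi k) → suc α ≢ β
      not-consecutive (inj₁ refl) (inj₁ refl) = 1+n≢n
      not-consecutive (inj₁ refl) (inj₂ refl) = <⇒≢ a+1<b
      not-consecutive (inj₂ refl) (inj₁ refl) = λ eq → <-asym (<⇒≤ a+1<b) (subst (hi k <_) eq (n<1+n (hi k)))
      not-consecutive (inj₂ refl) (inj₂ refl) = 1+n≢n
  ... | base α∈ eqα | top eqβ =
        next-≢ (level k) (sym (proj₁ (matched-in-one-level (base<m valid α∈) (top<m valid) (sym eqα) (sym eqβ))))
  ... | top eqα     | base β∈ eqβ =
        next-≢ (level k) (proj₁ (matched-in-one-level (top<m valid) (base<m valid β∈) (sym eqα) (sym eqβ)))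
  ... | top eqα     | top eqβ = 1+n≢n (trans eqβ (sym eqα))

  cyclicEdges : List (Subset n)
  cyclicEdges = map cyclicEdge cyclicKeys

  cyclicEdge-3set : ∀ {k} → ValidCyclicKey k → Is3Set (cyclicEdge k)
  cyclicEdge-3set {k} valid@(_ , l<3 , _) =
    ∣triple∣≡3 (vertex-<n l<3 lo<m) (vertex-<n l<3 (hi<m valid)) (vertex-<n (next<3 (level k)) (top<m valid))
      (<⇒≢ (lo<hi valid) ∘ vertex-cancel)
      (λ eq → next-≢ (level k) (sym (proj₁ (vertex-injective eq lo<m (top<m valid)))))
      (λ eq → next-≢ (level k) (sym (proj₁ (vertex-injective eq (hi<m valid) (top<m valid)))))
    where lo<m = <-trans (lo<hi valid) (hi<m valid)

  pairEdge≢cyclicEdge : ∀ {j x k} → j < 3 * q → ValidCyclicKey k → pairEdge (j , x) ≢ cyclicEdge k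
  pairEdge≢cyclicEdge {j} j<3q valid eq = cyclicEdge-unmatched valid
    (triple-≡⇒OneOf₃ eq (<M⇒<n (<-trans (n<1+n _) (pair<M j<3q))) (inj₁ refl))
    (triple-≡⇒OneOf₃ eq (<M⇒<n (pair<M j<3q)) (inj₂ (inj₁ refl)))

  H : Hypergraph3 n
  H = record
    { edges    = pairEdges ++ cyclicEdges
    ; uniform  = All.++⁺ pairEdges-3sets (All.map⁺ (All.tabulate (cyclicEdge-3set ∘ ∈-cyclicKeys⁻)))
    ; distinct = Unique.++⁺ pairEdges-unique
        (Unique-map⁺ cyclicEdge cyclicKeys-unique λ k∈ k′∈ → cyclicEdge-injective (∈-cyclicKeys⁻ k∈) (∈-cyclicKeys⁻ k′∈))
        λ (e∈pairs , e∈cyclic) → case ∈-map⁻ pairEdge e∈pairs , ∈-map⁻ cyclicEdge e∈cyclic of λ where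
          ((_ , k∈ , refl) , (_ , k′∈ , eq)) → pairEdge≢cyclicEdge (proj₁ (∈-keys⁻ k∈)) (∈-cyclicKeys⁻ k′∈) eq
    }

  size-H : size H ≡ 3 * q * (M ∸ 2) + t′ * (3 * T)
  size-H = begin
    length (pairEdges ++ cyclicEdges)                      ≡⟨ length-++ pairEdges ⟩
    length pairEdges + length cyclicEdges                  ≡⟨ cong₂ _+_ length-pairEdges (length-map cyclicEdge cyclicKeys) ⟩
    sum (map (length ∘ others) (downFrom (3 * q))) + length cyclicKeys
      ≡⟨ cong₂ _+_ (sum-map-const _ (downFrom (3 * q)) (length-others ∘ ∈-downFrom⁻)) length-cyclicKeys ⟩
    length (downFrom (3 * q)) * (M ∸ 2) + t′ * (3 * T)     ≡⟨ cong (λ c → c * (M ∸ 2) + t′ * (3 * T)) (length-downFrom (3 * q)) ⟩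
    3 * q * (M ∸ 2) + t′ * (3 * T)                         ∎
    where open ≡-Reasoning

  -- An unmatched pair lies on at most one hyperedge through u's matched pair, one through v's,
  -- and one cyclic hyperedge per shift: at most 2 + t′ hyperedges.
  CyclicTag : ℕ → ℕ → Subset n → ℕ → Set
  CyclicTag U V e j = (j ≡ 0 × Through U V e) ⊎ (j ≡ 1 × Through V U e)
    ⊎ (∃[ k ] k ∈ₗ cyclicKeys × j ≡ 2 + shift k × e ≡ cyclicEdge k × OnEdge U k × OnEdge V k)

  CyclicTag-injective : ∀ {U V e e′ j} → U ≢ V → CyclicTag U V e j → CyclicTag U V e′ j → e ≡ e′
  CyclicTag-injective _ (inj₁ (_ , _ , _ , _ , refl)) (inj₁ (_ , _ , _ , _ , refl)) = refl
  CyclicTag-injective _ (inj₂ (inj₁ (_ , _ , _ , _ , refl))) (inj₂ (inj₁ (_ , _ , _ , _ , refl))) = refl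
  CyclicTag-injective U≢V (inj₂ (inj₂ (k , k∈ , refl , refl , U-on , V-on))) (inj₂ (inj₂ (k′ , k′∈ , j≡ , refl , U-on′ , V-on′))) =
    cong cyclicEdge (shared-pair⇒same-key (∈-cyclicKeys⁻ k∈) (∈-cyclicKeys⁻ k′∈) (suc-injective (suc-injective j≡)) U≢V U-on V-on U-on′ V-on′)
  CyclicTag-injective _ (inj₁ (refl , _)) (inj₂ (inj₁ (() , _)))
  CyclicTag-injective _ (inj₁ (refl , _)) (inj₂ (inj₂ (_ , _ , () , _)))
  CyclicTag-injective _ (inj₂ (inj₁ (refl , _))) (inj₁ (() , _))
  CyclicTag-injective _ (inj₂ (inj₁ (refl , _))) (inj₂ (inj₂ (_ , _ , () , _)))
  CyclicTag-injective _ (inj₂ (inj₂ (_ , _ , refl , _))) (inj₁ (() , _))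
  CyclicTag-injective _ (inj₂ (inj₂ (_ , _ , refl , _))) (inj₂ (inj₁ (() , _)))

  cyclicTag : ∀ {u v e} → u ≢ v → toℕ v ≢ partner (toℕ u) → e ∈ₗ edges H → u ∈ e → v ∈ e →
              ∃[ j ] j < 2 + t′ × CyclicTag (toℕ u) (toℕ v) e j
  cyclicTag {u} {v} u≢v unmatched e∈ u∈e v∈e with ∈-++⁻ pairEdges e∈
  ... | inj₁ e∈pairs with pairEdge-through e∈pairs u∈e v∈e u≢v unmatched
  ...   | inj₁ uv = 0 , s≤s z≤n , inj₁ (refl , uv)
  ...   | inj₂ vu = 1 , s≤s (s≤s z≤n) , inj₂ (inj₁ (refl , vu))
  cyclicTag {u} {v} u≢v unmatched e∈ u∈e v∈e | inj₂ e∈cyclic with ∈-map⁻ cyclicEdge e∈cyclic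
  ... | k , k∈ , refl = 2 + shift k , s≤s (s≤s (proj₁ (∈-cyclicKeys⁻ k∈))) ,
                        inj₂ (inj₂ (k , k∈ , refl , refl , ∈-triple⁻ u u∈e , ∈-triple⁻ v v∈e))

  H-free : HeavyS2Free (3 + t′) H
  H-free = unmatched-light⇒HeavyS2Free H λ u v u≢v unmatched →
    ¬HeavyPair-if-tagged H (2 + t′) ≤-refl (CyclicTag (toℕ u) (toℕ v)) (cyclicTag u≢v unmatched)
      (CyclicTag-injective (u≢v ∘ toℕ-injective))

  triangle : ∀ p → 2 * sum (map (_∸ 1) (downFrom (suc p))) + p ≡ p * p
  triangle zero    = refl
  triangle (suc p) = begin
    2 * (p + S) + suc p       ≡⟨ regroup p S ⟩
    (2 * S + p) + suc (2 * p) ≡⟨ cong (_+ suc (2 * p)) (triangle p) ⟩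
    p * p + suc (2 * p)       ≡⟨ square p ⟩
    suc p * suc p             ∎
    where
      open ≡-Reasoning
      S = sum (map (_∸ 1) (downFrom (suc p)))
      regroup : ∀ p S → 2 * (p + S) + suc p ≡ (2 * S + p) + suc (2 * p)
      regroup = solve-∀
      square : ∀ p → p * p + suc (2 * p) ≡ suc p * suc p
      square = solve-∀

  T≡ : T ≡ (2 * q′ + 1) * q′
  T≡ = *-cancelˡ-≡ T ((2 * q′ + 1) * q′) 2 (+-cancelʳ-≡ (suc (double q′)) (2 * T) _ (begin
    2 * T + suc (double q′)                        ≡⟨ triangle (suc (double q′)) ⟩
    suc (double q′) * suc (double q′)              ≡⟨ cong (λ d → suc d * suc d) (double≡2* q′) ⟩
    suc (2 * q′) * suc (2 * q′)                    ≡⟨ expand q′ ⟩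
    2 * ((2 * q′ + 1) * q′) + suc (2 * q′)         ≡⟨ cong (λ d → 2 * ((2 * q′ + 1) * q′) + suc d) (double≡2* q′) ⟨
    2 * ((2 * q′ + 1) * q′) + suc (double q′)      ∎))
    where
      open ≡-Reasoning
      expand : ∀ q′ → suc (2 * q′) * suc (2 * q′) ≡ 2 * ((2 * q′ + 1) * q′) + suc (2 * q′)
      expand = solve-∀

  M∸2≡ : M ∸ 2 ≡ 6 * q′ + 4
  M∸2≡ = cong (_∸ 2) (trans (double≡2* (3 * q)) (expand q′))
    where
      expand : ∀ q′ → 2 * (3 * suc q′) ≡ 2 + (6 * q′ + 4)
      expand = solve-∀

  size-H≡ : size H ≡ 3 * q * (6 * q′ + 4) + t′ * (3 * ((2 * q′ + 1) * q′))
  size-H≡ = trans size-H (cong₂ (λ d t → 3 * q * d + t′ * (3 * t)) M∸2≡ T≡)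

matching-bound : ∀ k q → 2 * k + 2 ≤ q → k * ((2 * q + 1) * (2 * q + 1)) + 4 * suc k * q ≤ 4 * suc k * (q * q)
matching-bound k q 2k+2≤q with d , refl ← m≤n⇒∃[o]m+o≡n 2k+2≤q =
  ≤-trans (m≤m+n _ (7 * k + 8 + 12 * d + 8 * k * d + 4 * d * d)) (≤-reflexive (sym (expand k d)))
  where
    expand : ∀ k d → let q = 2 * k + 2 + d in
      4 * suc k * (q * q) ≡ k * ((2 * q + 1) * (2 * q + 1)) + 4 * suc k * q + (7 * k + 8 + 12 * d + 8 * k * d + 4 * d * d)
    expand = solve-∀

square-bound : ∀ c Q → 8 * suc c + 1 ≤ Q → c * ((6 * Q + 11) * (6 * Q + 11)) ≤ 36 * suc c * (Q * Q)
square-bound c Q Q≥ with d , refl ← m≤n⇒∃[o]m+o≡n Q≥ =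
  ≤-trans (m≤m+n _ (2916 + 648 * d + 36 * d * d + 3875 * c + 444 * c * d + 1248 * c * c)) (≤-reflexive (sym (expand c d)))
  where
    expand : ∀ c d → let Q = 8 * suc c + 1 + d in
      36 * suc c * (Q * Q) ≡ c * ((6 * Q + 11) * (6 * Q + 11)) + (2916 + 648 * d + 36 * d * d + 3875 * c + 444 * c * d + 1248 * c * c)
    expand = solve-∀

cyclic-size-bound : ∀ t′ Q → 6 * (3 + t′) * (Q * Q) ≤ 3 * suc Q * (6 * Q + 4) + t′ * (3 * ((2 * Q + 1) * Q))
cyclic-size-bound t′ Q = ≤-trans (m≤m+n _ (30 * Q + 12 + 3 * t′ * Q)) (≤-reflexive (sym (expand t′ Q)))
  where
    expand : ∀ t′ Q → 3 * suc Q * (6 * Q + 4) + t′ * (3 * ((2 * Q + 1) * Q)) ≡ 6 * (3 + t′) * (Q * Q) + (30 * Q + 12 + 3 * t′ * Q)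
    expand = solve-∀

n≤double : ∀ n → n ≤ double n
n≤double zero    = z≤n
n≤double (suc n) = s≤s (≤-trans (n≤double n) (n≤1+n _))

n≤[d∸1]+[n/d]*d : ∀ n d .{{_ : NonZero d}} → n ≤ (d ∸ 1) + n / d * d
n≤[d∸1]+[n/d]*d n d@(suc d′) = subst (_≤ d′ + n / d * d) (sym (m≡m%n+[m/n]*n n d)) (+-monoˡ-≤ (n / d * d) (s≤s⁻¹ (m%n<n n d)))

lower-bound-i : ∀ k n → (2 * k + 2) * 2 ≤ n →
  Σ (Hypergraph3 n) λ H → HeavyS2Free 2 H × (k * (n * n) ≤ 4 * suc k * size H)
lower-bound-i k n n≥N = H , H-free , bound
  where
    q = n / 2
    2q≤n : double q ≤ n
    2q≤n = subst (_≤ n) (trans (*-comm q 2) (sym (double≡2* q))) (m/n*n≤m n 2)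
    n≤2q+1 : n ≤ 2 * q + 1
    n≤2q+1 = subst (n ≤_) (trans (+-comm 1 (q * 2)) (cong (_+ 1) (*-comm q 2))) (n≤[d∸1]+[n/d]*d n 2)
    q≥ : 2 * k + 2 ≤ q
    q≥ = subst (_≤ q) (m*n/n≡m (2 * k + 2) 2) (/-monoˡ-≤ 2 n≥N)
    open MatchingConstruction q 2q≤n
    open ≤-Reasoning
    bound : k * (n * n) ≤ 4 * suc k * size H
    bound = +-cancelʳ-≤ (4 * suc k * q) _ _ (begin
      k * (n * n) + 4 * suc k * q                       ≤⟨ +-monoˡ-≤ _ (*-monoʳ-≤ k (*-mono-≤ n≤2q+1 n≤2q+1)) ⟩
      k * ((2 * q + 1) * (2 * q + 1)) + 4 * suc k * q   ≤⟨ matching-bound k q q≥ ⟩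
      4 * suc k * (q * q)                               ≡⟨ cong (4 * suc k *_) size-H ⟨
      4 * suc k * (size H + q)                          ≡⟨ *-distribˡ-+ (4 * suc k) (size H) q ⟩
      4 * suc k * size H + 4 * suc k * q                ∎)

upper-bound-i : ∀ k {n} (H : Hypergraph3 n) → HeavyS2Free 2 H → 4 * suc k * size H ≤ (k + 2) * (n * n)
upper-bound-i k {n} H free = begin
  4 * suc k * size H   ≡⟨ trans (cong (_* size H) (*-comm 4 (suc k))) (*-assoc (suc k) 4 (size H)) ⟩
  suc k * (4 * size H) ≤⟨ *-monoʳ-≤ (suc k) (UpperBound.4*size≤n*n H free) ⟩
  suc k * (n * n)      ≤⟨ *-monoˡ-≤ (n * n) (subst (suc k ≤_) (+-comm 2 k) (n≤1+n (suc k))) ⟩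
  (k + 2) * (n * n)    ∎
  where open ≤-Reasoning

lower-bound-ii : ∀ t′ k n → (8 * ((3 + t′) * suc k) + 2) * 6 ≤ n →
  Σ (Hypergraph3 n) λ H → HeavyS2Free (3 + t′) H × (((3 + t′) * suc k ∸ 1) * (n * n) ≤ 6 * suc k * size H)
lower-bound-ii t′ k n n≥N = with-quotient (n / 6) (m/n*n≤m n 6) (n≤[d∸1]+[n/d]*d n 6)
  (subst (_≤ n / 6) (trans (m*n/n≡m (8 * ((3 + t′) * suc k) + 2) 6) (+-suc (8 * ((3 + t′) * suc k)) 1)) (/-monoˡ-≤ 6 n≥N))
  where
    c = (3 + t′) * suc k ∸ 1
    with-quotient : ∀ q → q * 6 ≤ n → n ≤ 5 + q * 6 → suc (8 * suc c + 1) ≤ q →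
      Σ (Hypergraph3 n) λ H → HeavyS2Free (3 + t′) H × (c * (n * n) ≤ 6 * suc k * size H)
    with-quotient (suc Q) 6q≤n n≤5+6q (s≤s Q≥) = H , H-free , bound
      where
        M≤n : double (3 * suc Q) ≤ n
        M≤n = subst (_≤ n) (trans (*-comm (suc Q) 6) (sym (trans (double≡2* (3 * suc Q)) (sym (*-assoc 2 3 (suc Q)))))) 6q≤n
        t′≤m : t′ ≤ double (suc Q)
        t′≤m = begin
          t′                 ≤⟨ m≤n+m t′ 3 ⟩
          3 + t′             ≤⟨ m≤m*n (3 + t′) (suc k) ⟩
          suc c              ≤⟨ m≤n*m (suc c) 8 ⟩
          8 * suc c          ≤⟨ m≤m+n (8 * suc c) 1 ⟩
          8 * suc c + 1      ≤⟨ Q≥ ⟩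
          Q                  ≤⟨ n≤1+n Q ⟩
          suc Q              ≤⟨ n≤double (suc Q) ⟩
          double (suc Q)     ∎
          where open ≤-Reasoning
        n≤6Q+11 : n ≤ 6 * Q + 11
        n≤6Q+11 = subst (n ≤_) (regroup Q) n≤5+6q
          where
            regroup : ∀ Q → 5 + suc Q * 6 ≡ 6 * Q + 11
            regroup = solve-∀
        open CyclicConstruction Q t′ M≤n t′≤m
        rescale : ∀ t′ k Q → 36 * ((3 + t′) * suc k) * (Q * Q) ≡ 6 * suc k * (6 * (3 + t′) * (Q * Q))
        rescale = solve-∀
        open ≤-Reasoning
        bound : c * (n * n) ≤ 6 * suc k * size H
        bound = begin
          c * (n * n)                               ≤⟨ *-monoʳ-≤ c (*-mono-≤ n≤6Q+11 n≤6Q+11) ⟩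
          c * ((6 * Q + 11) * (6 * Q + 11))         ≤⟨ square-bound c Q Q≥ ⟩
          36 * suc c * (Q * Q)                      ≡⟨ rescale t′ k Q ⟩
          6 * suc k * (6 * (3 + t′) * (Q * Q))      ≤⟨ *-monoʳ-≤ (6 * suc k) (cyclic-size-bound t′ Q) ⟩
          6 * suc k * (3 * suc Q * (6 * Q + 4) + t′ * (3 * ((2 * Q + 1) * Q))) ≡⟨ cong (6 * suc k *_) size-H≡ ⟨
          6 * suc k * size H                        ∎

proposition10 :
    -- (i) ex₃(n, ℍ₂³S₂) = (1 + o(1)) n²/4 : for every ε = 1/(k+1) > 0 there is N
    -- such that for all n ≥ N, (1 - ε) n²/4 ≤ ex₃(n, ℍ₂³S₂) ≤ (1 + ε) n²/4.
    ((k : ℕ) → ∃[ N ] ((n : ℕ) → n ≥ N →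
        (Σ (Hypergraph3 n) λ H → HeavyS2Free 2 H ×
            (k * (n * n) ≤ 4 * (suc k) * size H))
        × ((H : Hypergraph3 n) → HeavyS2Free 2 H →
            4 * (suc k) * size H ≤ (k + 2) * (n * n))))
    ×
    -- (ii) for every t ≥ 3, ex₃(n, ℍₜ³S₂) ≥ (t + o(1)) n²/6 : for every
    -- ε = 1/(k+1) > 0 there is N such that for all n ≥ N,
    -- ex₃(n, ℍₜ³S₂) ≥ (t - ε) n²/6.
    ((t : ℕ) → t ≥ 3 → (k : ℕ) → ∃[ N ] ((n : ℕ) → n ≥ N →
        Σ (Hypergraph3 n) λ H → HeavyS2Free t H ×
            ((t * suc k ∸ 1) * (n * n) ≤ 6 * (suc k) * size H)))
proposition10 =
  (λ k → (2 * k + 2) * 2 , λ n n≥N → lower-bound-i k n n≥N , upper-bound-i k) ,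
  λ where (suc (suc (suc t′))) (s≤s (s≤s (s≤s _))) k → (8 * ((3 + t′) * suc k) + 2) * 6 , lower-bound-ii t′ k
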